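{- Let $d\geq1$, $k\geq 3$, let $N_1,\dots,N_d$ be non-negative integers, $P=([-N_1,N_1]\times\cdots\times[-N_d,N_d])\cap\mathbb{Z}^d$, and let $A_1,\dots,A_k\subset P$ with $|A_1|\leq\cdots\leq|A_k|$. Assume that $A_k$ is a down-set. Then for every $s\in\mathbb{Z}^d$, \[ S_k(A_1,\dots,A_k;s)\geq E_k(A_1,\dots,A_k)-O_s(|A_1|\cdots|A_{k-2}|\,\lambda(\partial P)), \] where $\lambda(\partial P)=|P|\sum_{i=1}^d(2N_i+1)^{ -1}$ and the implied constant depends only on $s$, $k$ and $d$.
   Context: For finite $A_1,\dots,A_k\subset\mathbb{Z}^d$ and $s\in\mathbb{Z}^d$, $S_k(A_1,\dots,A_k;s)$ is the number of $(a_1,\dots,a_k)\in A_1\times\cdots\times A_k$ with $a_1+\cdots+a_k=s$, and $E_k(A_1,\dots,A_k)=S_k(A_1,\dots,A_k;0)$. For $1\leq i\leq d$ identify $\mathbb{Z}^d$ with $\mathbb{Z}^{d-1}\times\mathbb{Z}$ via $(x_1,\dots,x_d)\mapsto((x_1,\dots,x_{i-1},x_{i+1},\dots,x_d),x_i)$. For finite $A\subset\mathbb{Z}^d$ and $b\in\mathbb{Z}^{d-1}$ let $J_i(A;b)=\{c\in\mathbb{Z}:(b,c)\in A\}$ and $\ell_i(A;b)=\#J_i(A;b)$. For a positive integer $\ell$ let $I(\ell)=[-\lfloor \ell/2\rfloor,\lfloor\ell/2\rfloor]\cap\mathbb{Z}$. The $i$-compression is $C_i(A)=\bigcup_{b\in\mathbb{Z}^{d-1},\,\ell_i(A;b)>0}\{b\}\times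 I(\ell_i(A;b))$. $A$ is $i$-compressed if $C_i(A)=A$, and a down-set if it is $i$-compressed for every $1\leq i\leq d$. -}

module Defs where

open import Data.Nat as ℕ using (ℕ; zero; suc)
open import Data.Nat.DivMod using (_/_)
open import Data.Integer as ℤ using (ℤ; +_; 0ℤ; -_)
open import Data.Fin using (Fin; toℕ)
open import Data.Vec as V using (Vec; _[_]≔_; lookup; zipWith; replicate)
open import Data.Vec.Properties using (≡-dec)
open import Data.List as L using (List; length; filter; allFin)
open import Data.Nat.ListAction using (sum; product)
open import Data.List.Membership.Propositional using (_∈_)
open import Data.Product using (_×_)
open import Function.Bundles using (_⇔_)
open import Relation.Nullary using (Dec; yes; no)
open import Relation.Binary.PropositionalEquality using (_≡_)

Pt : ℕ → Set
Pt d = Vec ℤ d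

_≟ᵖ_ : ∀ {d} (x y : Pt d) → Dec (x ≡ y)
_≟ᵖ_ = ≡-dec ℤ._≟_

0ᵖ : ∀ {d} → Pt d
0ᵖ = replicate _ 0ℤ

_-ᵖ_ : ∀ {d} → Pt d → Pt d → Pt d
_-ᵖ_ = zipWith ℤ._-_

-- finite subsets of ℤ^d are lists; duplicate-freeness is imposed in the statement
FinSet : ℕ → Set
FinSet d = List (Pt d)

S : ∀ {d} (k : ℕ) → (Fin k → FinSet d) → Pt d → ℕ
S zero A s with s ≟ᵖ 0ᵖ
... | yes _ = 1
... | no _ = 0
S (suc k) A s = sum (L.map (λ a → S k (λ i → A (Fin.suc i)) (s -ᵖ a)) (A Fin.zero))
  where import Data.Fin as Fin

E : ∀ {d} (k : ℕ) → (Fin k → FinSet d) → ℕ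
E k A = S k A 0ᵖ

-- The base point b ∈ ℤ^{d-1} of x (x with its i-th coordinate deleted) is encoded
-- as x with its i-th coordinate set to 0.
base : ∀ {d} → Fin d → Pt d → Pt d
base i x = x [ i ]≔ 0ℤ

J : ∀ {d} → Fin d → FinSet d → Pt d → List ℤ
J i A x = L.map (λ a → lookup a i) (filter (λ a → base i a ≟ᵖ base i x) A)

-- ℓ_i(A; b)  (A is duplicate-free, so this is #J_i(A;b))
ℓ : ∀ {d} → Fin d → FinSet d → Pt d → ℕ
ℓ i A x = length (J i A x)

InI : ℕ → ℤ → Set
InI m c = (- (+ (m / 2))) ℤ.≤ c × c ℤ.≤ + (m / 2)

InCompression : ∀ {d} → Fin d → FinSet d → Pt d → Set
InCompression i A x = 0 ℕ.< ℓ i A x × InI (ℓ i A x) (lookup x i)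

Compressed : ∀ {d} → Fin d → FinSet d → Set
Compressed i A = ∀ x → (x ∈ A) ⇔ InCompression i A x

DownSet : ∀ {d} → FinSet d → Set
DownSet {d} A = ∀ (i : Fin d) → Compressed i A

InBox : ∀ {d} → (Fin d → ℕ) → Pt d → Set
InBox {d} N x = ∀ (j : Fin d) → (- (+ N j)) ℤ.≤ lookup x j × lookup x j ℤ.≤ + N j

boxSize : ∀ {d} → (Fin d → ℕ) → ℕ
boxSize {d} N = product (L.map (λ j → suc (2 ℕ.* N j)) (allFin d))

-- λ(∂P) = |P| Σ_i (2N_i+1)^{-1}  =  Σ_i |P|/(2N_i+1)  (each division is exact)
boundary : ∀ {d} → (Fin d → ℕ) → ℕ
boundary {d} N = sum (L.map (λ i → boxSize N / suc (2 ℕ.* N i)) (allFin d))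

-- |A_1| ⋯ |A_{k-2}|  (indices are 0-based: i with toℕ i + 2 < k)
prodFirst : ∀ {d} (k : ℕ) → (Fin k → FinSet d) → ℕ
prodFirst k A = product (L.map (λ i → length (A i)) (filter (λ i → suc (suc (toℕ i)) ℕ.<? k) (allFin k)))

-- Writing t′ = t + s, each of the first k − 2 sums is bounded termwise, which costs the factor
-- |A₁| ⋯ |A_{k−2}| and leaves the case of two sets X and D, D a down-set. There the terms a ∈ X
-- counted at t but not at t′ have t − a ∈ D and t′ − a ∉ D, so the walk from t − a to t′ − a,
-- one coordinate at a time, has a step i that leaves D. As D is i-compressed, a point of D whose
-- i-th step leaves D lies within |s_i| of the end of its fibre; replacing its i-th coordinate by
-- that distance is injective and lands in a box of |s_i| · |P|/(2N_i + 1) points. Summing over i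
-- bounds the loss by (Σ|s_i|) λ(∂P).
module Submission where

open import Defs
open import Data.Nat using (ℕ; _≤_; _+_; _*_)
open import Data.Fin using (Fin; toℕ)
open import Data.Product using (∃)
open import Data.List using (length)
open import Data.List.Relation.Unary.All using (All)
open import Data.List.Relation.Unary.Unique.Propositional using (Unique)
open import Relation.Binary.PropositionalEquality using (_≡_)

open import Data.Nat using (zero; suc; _<_; _<?_; z≤n; s≤s)
open import Data.Nat.Properties
open import Data.Nat.DivMod using (_/_; m*n/n≡m)
open import Data.Nat.ListAction using (sum; product)
open import Data.Nat.Tactic.RingSolver using (solve-∀)
open import Algebra.Properties.CommutativeSemigroup +-commutativeSemigroup using ()
  renaming (interchange to +-interchange)
open import Data.Integer as ℤ using (ℤ; +_; 0ℤ; -_; ∣_∣)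
import Data.Integer.Properties as ℤ
import Data.Integer.Tactic.RingSolver as ℤ
open import Algebra.Properties.AbelianGroup ℤ.+-0-abelianGroup using ()
  renaming (∙-cancelˡ to ℤ-+-cancelˡ; ∙-cancelʳ to ℤ-+-cancelʳ)
open import Data.Bool using (true; false; if_then_else_)
open import Data.Fin as Fin using (zero; suc; fromℕ)
open import Data.Fin.Properties using (toℕ-fromℕ)
open import Data.Vec using ([]; _∷_; lookup; zipWith; _[_]≔_)
open import Data.Vec.Properties
  using (∷-injective; zipWith-identityˡ; []≔-idempotent; []≔-lookup; lookup∘update; lookup∘update′)
open import Data.Vec.Functional using (updateAt)
open import Data.Vec.Functional.Properties using (updateAt-updates; updateAt-minimal; updateAt-id-local)
open import Data.List using (List; []; _∷_; [_]; map; _++_; filter; allFin; tabulate; applyUpTo; cartesianProductWith)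
open import Data.List.Properties
  using (length-map; length-++; length-applyUpTo; map-cong; map-tabulate; tabulate-cong)
open import Data.List.Relation.Unary.All as All using ([]; _∷_)
open import Data.List.Relation.Unary.All.Properties using (All¬⇒¬Any; all-filter)
  renaming (map⁺ to All-map⁺)
open import Data.List.Relation.Unary.Any using (here; there)
open import Data.List.Relation.Unary.Unique.Propositional using ([]; _∷_)
import Data.List.Relation.Unary.Unique.Propositional.Properties as Unique
open import Data.List.Relation.Binary.Subset.Propositional using (_⊆_)
open import Data.List.Membership.Propositional using (_∈_; _∉_)
open import Data.List.Membership.Propositional.Properties using (∈-applyUpTo⁺; ∈-cartesianProductWith⁺)
import Data.List.Membership.DecPropositional as DecMembership
open import Data.Product using (_×_; _,_)
open import Data.Empty using (⊥-elim)
open import Function using (_∘_; const; Injective)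
open import Function.Bundles using (Equivalence)
open import Relation.Nullary using (Dec; yes; no; ¬_; does; ¬?; _×-dec_)
open import Relation.Unary using (Pred; Decidable)
open import Relation.Binary.PropositionalEquality hiding ([_])

𝟙 : ∀ {p} {P : Set p} → Dec P → ℕ
𝟙 P? = if does P? then 1 else 0

𝟙-of-yes : ∀ {p} {P : Set p} (P? : Dec P) → P → 𝟙 P? ≡ 1
𝟙-of-yes (yes _) _ = refl
𝟙-of-yes (no ¬p) p = ⊥-elim (¬p p)

𝟙-of-no : ∀ {p} {P : Set p} (P? : Dec P) → ¬ P → 𝟙 P? ≡ 0
𝟙-of-no (yes p) ¬p = ⊥-elim (¬p p)
𝟙-of-no (no _) _ = refl

𝟙-⇔ : ∀ {p q} {P : Set p} {Q : Set q} → (P → Q) → (Q → P) → (P? : Dec P) (Q? : Dec Q) → 𝟙 P? ≡ 𝟙 Q?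
𝟙-⇔ _ _ (yes _) (yes _) = refl
𝟙-⇔ _ _ (no _) (no _) = refl
𝟙-⇔ P→Q _ (yes p) (no ¬q) = ⊥-elim (¬q (P→Q p))
𝟙-⇔ _ Q→P (no ¬p) (yes q) = ⊥-elim (¬p (Q→P q))

module _ {a} {A : Set a} where

  sum-map-+ : (f g : A → ℕ) (xs : List A) →
    sum (map (λ x → f x + g x) xs) ≡ sum (map f xs) + sum (map g xs)
  sum-map-+ f g [] = refl
  sum-map-+ f g (x ∷ xs) =
    trans (cong (_+_ (f x + g x)) (sum-map-+ f g xs)) (+-interchange (f x) (g x) _ _)

  sum-map-mono : {f g : A → ℕ} → (∀ x → f x ≤ g x) → (xs : List A) → sum (map f xs) ≤ sum (map g xs)
  sum-map-mono f≤g [] = z≤n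
  sum-map-mono f≤g (x ∷ xs) = +-mono-≤ (f≤g x) (sum-map-mono f≤g xs)

  sum-map-const : (c : ℕ) (xs : List A) → sum (map (λ _ → c) xs) ≡ length xs * c
  sum-map-const c [] = refl
  sum-map-const c (x ∷ xs) = cong (_+_ c) (sum-map-const c xs)

  sum-map-*-≤ : (f g : A → ℕ) (xs : List A) →
    sum (map (λ x → f x * g x) xs) ≤ sum (map f xs) * sum (map g xs)
  sum-map-*-≤ f g [] = z≤n
  sum-map-*-≤ f g (x ∷ xs) = begin
    f x * g x + sum (map (λ x → f x * g x) xs) ≤⟨ +-monoʳ-≤ (f x * g x) (sum-map-*-≤ f g xs) ⟩
    f x * g x + F * G                          ≤⟨ +-monoʳ-≤ (f x * g x) (m≤n+m (F * G) (f x * G + F * g x)) ⟩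
    f x * g x + (f x * G + F * g x + F * G)    ≡⟨ expand (f x) (g x) F G ⟩
    (f x + F) * (g x + G)                      ∎
    where
    open ≤-Reasoning
    F = sum (map f xs)
    G = sum (map g xs)
    expand : ∀ a b c e → a * b + (a * e + c * b + c * e) ≡ (a + c) * (b + e)
    expand = solve-∀

  sum-map-𝟙 : {P : Pred A a} (P? : Decidable P) (xs : List A) →
    sum (map (λ x → 𝟙 (P? x)) xs) ≡ length (filter P? xs)
  sum-map-𝟙 P? [] = refl
  sum-map-𝟙 P? (x ∷ xs) with P? x
  ... | yes _ = cong suc (sum-map-𝟙 P? xs)
  ... | no _ = sum-map-𝟙 P? xs

  private
    remove : ∀ {x : A} (ys : List A) → x ∈ ys → List A
    remove (_ ∷ ys) (here _) = ys
    remove (y ∷ ys) (there p) = y ∷ remove ys p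

    length-remove : ∀ {x : A} (ys : List A) (p : x ∈ ys) → length ys ≡ suc (length (remove ys p))
    length-remove (_ ∷ ys) (here _) = refl
    length-remove (y ∷ ys) (there p) = cong suc (length-remove ys p)

    ∈-remove : ∀ {x y : A} (ys : List A) (p : x ∈ ys) → y ∈ ys → y ≢ x → y ∈ remove ys p
    ∈-remove (_ ∷ ys) (here refl) (here refl) y≢x = ⊥-elim (y≢x refl)
    ∈-remove (_ ∷ ys) (here _) (there q) _ = q
    ∈-remove (_ ∷ ys) (there p) (here refl) _ = here refl
    ∈-remove (_ ∷ ys) (there p) (there q) y≢x = there (∈-remove ys p q y≢x)

  Unique∧⊆⇒length≤ : {xs ys : List A} → Unique xs → xs ⊆ ys → length xs ≤ length ys
  Unique∧⊆⇒length≤ {[]} _ _ = z≤n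
  Unique∧⊆⇒length≤ {x ∷ xs} {ys} (x∉xs ∷ xs!) xs⊆ys = begin
    suc (length xs)               ≤⟨ s≤s (Unique∧⊆⇒length≤ xs! xs⊆ys-x) ⟩
    suc (length (remove ys x∈ys)) ≡⟨ length-remove ys x∈ys ⟨
    length ys                     ∎
    where
    open ≤-Reasoning
    x∈ys = xs⊆ys (here refl)
    xs⊆ys-x : xs ⊆ remove ys x∈ys
    xs⊆ys-x y∈xs = ∈-remove ys x∈ys (xs⊆ys (there y∈xs)) (λ { refl → All¬⇒¬Any x∉xs y∈xs })

module _ {a p} {A : Set a} {P : Pred A p} (P? : Decidable P) where

  leaves : A → A → ℕ
  leaves x y = 𝟙 (P? x ×-dec ¬? (P? y))

  𝟙≤𝟙+leaves : ∀ x y → 𝟙 (P? x) ≤ 𝟙 (P? y) + leaves x y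
  𝟙≤𝟙+leaves x y with P? x | P? y
  ... | yes _ | yes _ = s≤s z≤n
  ... | yes _ | no _ = s≤s z≤n
  ... | no _ | _ = z≤n

  leaves-self : ∀ x → leaves x x ≡ 0
  leaves-self x with P? x
  ... | yes _ = refl
  ... | no _ = refl

  leaves-triangle : ∀ x y z → leaves x z ≤ leaves x y + leaves y z
  leaves-triangle x y z with P? x | P? y | P? z
  ... | yes _ | yes _ | no _ = s≤s z≤n
  ... | yes _ | no _ | no _ = s≤s z≤n
  ... | yes _ | _ | yes _ = z≤n
  ... | no _ | _ | _ = z≤n

InInterval : ℤ → ℕ → ℤ → Set
InInterval lo n x = lo ℤ.≤ x × x ℤ.< lo ℤ.+ + n

InRange : ∀ {d} → (Fin d → ℤ) → (Fin d → ℕ) → Pt d → Set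
InRange lo n x = ∀ j → InInterval (lo j) (n j) (lookup x j)

interval : ℤ → ℕ → List ℤ
interval lo n = applyUpTo (λ k → lo ℤ.+ + k) n

∈-interval : ∀ {lo n x} → InInterval lo n x → x ∈ interval lo n
∈-interval {lo} {n} {x} (lo≤x , x<lo+n) = subst (_∈ interval lo n) lo+k≡x (∈-applyUpTo⁺ _ k<n)
  where
  k = ∣ x ℤ.- lo ∣
  +k≡x-lo : + k ≡ x ℤ.- lo
  +k≡x-lo = ℤ.0≤i⇒+∣i∣≡i (ℤ.i≤j⇒0≤j-i lo≤x)
  lo+[x-lo]≡x : ∀ lo x → lo ℤ.+ (x ℤ.- lo) ≡ x
  lo+[x-lo]≡x = ℤ.solve-∀
  lo+k≡x : lo ℤ.+ + k ≡ x
  lo+k≡x = trans (cong (λ z → lo ℤ.+ z) +k≡x-lo) (lo+[x-lo]≡x lo x)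
  [lo+n]-lo≡n : ∀ lo n → lo ℤ.+ n ℤ.- lo ≡ n
  [lo+n]-lo≡n = ℤ.solve-∀
  k<n : k < n
  k<n = ℤ.drop‿+<+ (subst₂ ℤ._<_ (sym +k≡x-lo) ([lo+n]-lo≡n lo (+ n)) (ℤ.+-monoˡ-< (- lo) x<lo+n))

length-cartesianProductWith : ∀ {a b c} {A : Set a} {B : Set b} {C : Set c} (f : A → B → C) xs ys →
  length (cartesianProductWith f xs ys) ≡ length xs * length ys
length-cartesianProductWith f [] ys = refl
length-cartesianProductWith f (x ∷ xs) ys = begin
  length (map (f x) ys ++ cartesianProductWith f xs ys)
    ≡⟨ length-++ (map (f x) ys) ⟩
  length (map (f x) ys) + length (cartesianProductWith f xs ys)
    ≡⟨ cong₂ _+_ (length-map (f x) ys) (length-cartesianProductWith f xs ys) ⟩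
  length ys + length xs * length ys
    ∎
  where open ≡-Reasoning

grid : ∀ {d} → (Fin d → ℤ) → (Fin d → ℕ) → List (Pt d)
grid {zero} lo n = [ [] ]
grid {suc d} lo n = cartesianProductWith _∷_ (interval (lo zero) (n zero)) (grid (lo ∘ suc) (n ∘ suc))

length-grid : ∀ {d} (lo : Fin d → ℤ) (n : Fin d → ℕ) → length (grid lo n) ≡ product (tabulate n)
length-grid {zero} lo n = refl
length-grid {suc d} lo n = begin
  length (grid lo n)
    ≡⟨ length-cartesianProductWith _∷_ (interval (lo zero) (n zero)) _ ⟩
  length (interval (lo zero) (n zero)) * length (grid (lo ∘ suc) (n ∘ suc))
    ≡⟨ cong₂ _*_ (length-applyUpTo _ (n zero)) (length-grid (lo ∘ suc) (n ∘ suc)) ⟩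
  n zero * product (tabulate (n ∘ suc))
    ∎
  where open ≡-Reasoning

∈-grid : ∀ {d} {lo : Fin d → ℤ} {n : Fin d → ℕ} {x : Pt d} → InRange lo n x → x ∈ grid lo n
∈-grid {zero} {x = []} _ = here refl
∈-grid {suc d} {x = c ∷ x} x∈ = ∈-cartesianProductWith⁺ _∷_ (∈-interval (x∈ zero)) (∈-grid (x∈ ∘ suc))

Unique∧InRange⇒length≤ : ∀ {d} {lo : Fin d → ℤ} {n : Fin d → ℕ} {xs : List (Pt d)} →
  Unique xs → All (InRange lo n) xs → length xs ≤ product (tabulate n)
Unique∧InRange⇒length≤ {lo = lo} {n} xs! xs∈ =
  subst (_ ≤_) (length-grid lo n) (Unique∧⊆⇒length≤ xs! (∈-grid ∘ All.lookup xs∈))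

product-updateAt : ∀ {d} (f : Fin d → ℕ) (i : Fin d) (c : ℕ) →
  product (tabulate (updateAt f i (const c))) ≡ product (tabulate (updateAt f i (const 1))) * c
product-updateAt {suc d} f zero c = c*p≡[1*p]*c c (product (tabulate (f ∘ suc)))
  where
  c*p≡[1*p]*c : ∀ c p → c * p ≡ (1 * p) * c
  c*p≡[1*p]*c = solve-∀
product-updateAt {suc d} f (suc i) c =
  trans (cong (f zero *_) (product-updateAt (f ∘ suc) i c)) (sym (*-assoc (f zero) _ c))

sideLength : ∀ {d} → (Fin d → ℕ) → Fin d → ℕ
sideLength N j = suc (2 * N j)

facetSize : ∀ {d} → (Fin d → ℕ) → Fin d → ℕ
facetSize N i = product (tabulate (updateAt (sideLength N) i (const 1)))

boxSize≡facetSize*sideLength : ∀ {d} (N : Fin d → ℕ) (i : Fin d) →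
  boxSize N ≡ facetSize N i * sideLength N i
boxSize≡facetSize*sideLength N i = begin
  product (map (sideLength N) (allFin _))
    ≡⟨ cong product (map-tabulate (λ j → j) (sideLength N)) ⟩
  product (tabulate (sideLength N))
    ≡⟨ cong product (tabulate-cong (updateAt-id-local i (sideLength N) refl)) ⟨
  product (tabulate (updateAt (sideLength N) i (const (sideLength N i))))
    ≡⟨ product-updateAt (sideLength N) i _ ⟩
  facetSize N i * sideLength N i
    ∎
  where open ≡-Reasoning

boundary≡sum-facetSize : ∀ {d} (N : Fin d → ℕ) → boundary N ≡ sum (map (facetSize N) (allFin d))
boundary≡sum-facetSize N = cong sum (map-cong boxSize/sideLength≡facetSize (allFin _))
  where
  boxSize/sideLength≡facetSize : ∀ i → boxSize N / sideLength N i ≡ facetSize N i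
  boxSize/sideLength≡facetSize i =
    trans (cong (_/ sideLength N i) (boxSize≡facetSize*sideLength N i)) (m*n/n≡m _ (sideLength N i))

_+ᵖ_ : ∀ {d} → Pt d → Pt d → Pt d
_+ᵖ_ = zipWith ℤ._+_

0ᵖ+ᵖ : ∀ {d} (s : Pt d) → 0ᵖ +ᵖ s ≡ s
0ᵖ+ᵖ = zipWith-identityˡ ℤ.+-identityˡ

[t-a]+s≡[t+s]-a : ∀ {d} (t a s : Pt d) → (t -ᵖ a) +ᵖ s ≡ (t +ᵖ s) -ᵖ a
[t-a]+s≡[t+s]-a [] [] [] = refl
[t-a]+s≡[t+s]-a (t ∷ ts) (a ∷ as) (s ∷ ss) = cong₂ _∷_ (comm t a s) ([t-a]+s≡[t+s]-a ts as ss)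
  where
  comm : ∀ t a s → t ℤ.- a ℤ.+ s ≡ t ℤ.+ s ℤ.- a
  comm = ℤ.solve-∀

-ᵖ-injective : ∀ {d} (t : Pt d) → Injective _≡_ _≡_ (t -ᵖ_)
-ᵖ-injective [] {[]} {[]} _ = refl
-ᵖ-injective (t ∷ ts) {a ∷ as} {b ∷ bs} eq with ∷-injective eq
... | t-a≡t-b , ts-as≡ts-bs =
  cong₂ _∷_ (ℤ.neg-injective (ℤ-+-cancelˡ t (- a) (- b) t-a≡t-b)) (-ᵖ-injective ts ts-as≡ts-bs)

-ᵖ≡0ᵖ⇒≡ : ∀ {d} (x y : Pt d) → x -ᵖ y ≡ 0ᵖ → x ≡ y
-ᵖ≡0ᵖ⇒≡ [] [] _ = refl
-ᵖ≡0ᵖ⇒≡ (x ∷ xs) (y ∷ ys) eq with ∷-injective eq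
... | x-y≡0 , xs-ys≡0 = cong₂ _∷_ (ℤ.i-j≡0⇒i≡j x y x-y≡0) (-ᵖ≡0ᵖ⇒≡ xs ys xs-ys≡0)

x-ᵖx≡0ᵖ : ∀ {d} (x : Pt d) → x -ᵖ x ≡ 0ᵖ
x-ᵖx≡0ᵖ [] = refl
x-ᵖx≡0ᵖ (x ∷ xs) = cong₂ _∷_ (ℤ.+-inverseʳ x) (x-ᵖx≡0ᵖ xs)

module _ {d : ℕ} where

  open DecMembership (_≟ᵖ_ {d}) using (_∈?_)

  S₁≡𝟙∈ : (A : Fin 1 → FinSet d) → Unique (A zero) → ∀ x → S 1 A x ≡ 𝟙 (x ∈? A zero)
  S₁≡𝟙∈ A = go (A zero)
    where
    go : ∀ (D : FinSet d) → Unique D → ∀ x → sum (map (λ b → S 0 (A ∘ suc) (x -ᵖ b)) D) ≡ 𝟙 (x ∈? D)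
    go [] [] x = refl
    go (b ∷ D) (b∉D ∷ D!) x with (x -ᵖ b) ≟ᵖ 0ᵖ
    ... | yes x-b≡0 = begin
      suc (sum (map _ D)) ≡⟨ cong suc (trans (go D D! x) (𝟙-of-no (x ∈? D) (All¬⇒¬Any b∉D ∘ subst (_∈ D) x≡b))) ⟩
      1                   ≡⟨ 𝟙-of-yes (x ∈? (b ∷ D)) (here x≡b) ⟨
      𝟙 (x ∈? (b ∷ D))    ∎
      where
      open ≡-Reasoning
      x≡b = -ᵖ≡0ᵖ⇒≡ x b x-b≡0
    ... | no x-b≢0 = trans (go D D! x) (𝟙-⇔ there ∈-tail (x ∈? D) (x ∈? (b ∷ D)))
      where
      ∈-tail : x ∈ b ∷ D → x ∈ D
      ∈-tail (here refl) = ⊥-elim (x-b≢0 (x-ᵖx≡0ᵖ x))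
      ∈-tail (there x∈D) = x∈D

exitDistance : ℤ → ℤ → ℤ → ℤ
exitDistance σ m x with 0ℤ ℤ.≤? σ
... | yes _ = m ℤ.- x
... | no _ = x ℤ.+ m

exitDistance-injective : ∀ σ m {x y} → exitDistance σ m x ≡ exitDistance σ m y → x ≡ y
exitDistance-injective σ m {x} {y} eq with 0ℤ ℤ.≤? σ
... | yes _ = ℤ.neg-injective (ℤ-+-cancelˡ m (- x) (- y) eq)
... | no _ = ℤ-+-cancelʳ m x y eq

exitDistance-range : ∀ σ m x → - m ℤ.≤ x → x ℤ.≤ m → ¬ (- m ℤ.≤ x ℤ.+ σ × x ℤ.+ σ ℤ.≤ m) →
  InInterval 0ℤ ∣ σ ∣ (exitDistance σ m x)
exitDistance-range σ m x -m≤x x≤m escapes with 0ℤ ℤ.≤? σ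
... | yes 0≤σ = ℤ.i≤j⇒0≤j-i x≤m , (begin-strict
  m ℤ.- x         <⟨ ℤ.+-monoˡ-< (- x) m<x+σ ⟩
  x ℤ.+ σ ℤ.- x   ≡⟨ [x+σ]-x≡σ x σ ⟩
  σ               ≡⟨ ℤ.0≤i⇒+∣i∣≡i 0≤σ ⟨
  + ∣ σ ∣         ∎)
  where
  open ℤ.≤-Reasoning
  x≤x+σ : x ℤ.≤ x ℤ.+ σ
  x≤x+σ = subst (ℤ._≤ x ℤ.+ σ) (ℤ.+-identityʳ x) (ℤ.+-monoʳ-≤ x 0≤σ)
  m<x+σ : m ℤ.< x ℤ.+ σ
  m<x+σ = ℤ.≰⇒> (λ x+σ≤m → escapes (ℤ.≤-trans -m≤x x≤x+σ , x+σ≤m))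
  [x+σ]-x≡σ : ∀ x σ → x ℤ.+ σ ℤ.- x ≡ σ
  [x+σ]-x≡σ = ℤ.solve-∀
... | no 0≰σ = subst (ℤ._≤ x ℤ.+ m) (ℤ.+-inverseˡ m) (ℤ.+-monoˡ-≤ m -m≤x) , (begin-strict
  x ℤ.+ m                   ≡⟨ [x+σ]+[m-σ]≡x+m x σ m ⟨
  x ℤ.+ σ ℤ.+ (m ℤ.- σ)     <⟨ ℤ.+-monoˡ-< (m ℤ.- σ) x+σ<-m ⟩
  - m ℤ.+ (m ℤ.- σ)         ≡⟨ -m+[m-σ]≡-σ m σ ⟩
  - σ                       ≡⟨ ℤ.0≤i⇒+∣i∣≡i (ℤ.neg-mono-≤ σ≤0) ⟨
  + ∣ - σ ∣                 ≡⟨ cong +_ (ℤ.∣-i∣≡∣i∣ σ) ⟩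
  + ∣ σ ∣                   ∎)
  where
  open ℤ.≤-Reasoning
  σ≤0 : σ ℤ.≤ 0ℤ
  σ≤0 = ℤ.<⇒≤ (ℤ.≰⇒> 0≰σ)
  x+σ≤x : x ℤ.+ σ ℤ.≤ x
  x+σ≤x = subst (x ℤ.+ σ ℤ.≤_) (ℤ.+-identityʳ x) (ℤ.+-monoʳ-≤ x σ≤0)
  x+σ<-m : x ℤ.+ σ ℤ.< - m
  x+σ<-m = ℤ.≰⇒> (λ -m≤x+σ → escapes (-m≤x+σ , ℤ.≤-trans x+σ≤x x≤m))
  [x+σ]+[m-σ]≡x+m : ∀ x σ m → x ℤ.+ σ ℤ.+ (m ℤ.- σ) ≡ x ℤ.+ m
  [x+σ]+[m-σ]≡x+m = ℤ.solve-∀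
  -m+[m-σ]≡-σ : ∀ m σ → - m ℤ.+ (m ℤ.- σ) ≡ - σ
  -m+[m-σ]≡-σ = ℤ.solve-∀

x≤n⇒x<-n+[1+2n] : ∀ {x} n → x ℤ.≤ + n → x ℤ.< - + n ℤ.+ + suc (2 * n)
x≤n⇒x<-n+[1+2n] {x} n x≤n = begin-strict
  x                                ≤⟨ x≤n ⟩
  + n                              <⟨ ℤ.+<+ (n<1+n n) ⟩
  + suc n                          ≡⟨ -n+[a+n]≡a (+ suc n) (+ n) ⟨
  - + n ℤ.+ (+ suc n ℤ.+ + n)      ≡⟨ cong (λ z → - + n ℤ.+ z) (ℤ.pos-+ (suc n) n) ⟨
  - + n ℤ.+ + (suc n + n)          ≡⟨ cong (λ k → - + n ℤ.+ + suc (n + k)) (+-identityʳ n) ⟨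
  - + n ℤ.+ + suc (2 * n)          ∎
  where
  open ℤ.≤-Reasoning
  -n+[a+n]≡a : ∀ a n → - n ℤ.+ (a ℤ.+ n) ≡ a
  -n+[a+n]≡a = ℤ.solve-∀

module _ {d : ℕ} where

  base-update : ∀ (i : Fin d) (w : Pt d) c → base i (w [ i ]≔ c) ≡ base i w
  base-update i w c = []≔-idempotent w i

  base∧lookup⇒≡ : ∀ (i : Fin d) {x y : Pt d} → base i x ≡ base i y → lookup x i ≡ lookup y i → x ≡ y
  base∧lookup⇒≡ i {x} {y} bx≡by xi≡yi = begin
    x                           ≡⟨ []≔-lookup x i ⟨
    x [ i ]≔ lookup x i         ≡⟨ []≔-idempotent x i ⟨
    base i x [ i ]≔ lookup x i  ≡⟨ cong₂ (_[ i ]≔_) bx≡by xi≡yi ⟩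
    base i y [ i ]≔ lookup y i  ≡⟨ []≔-idempotent y i ⟩
    y [ i ]≔ lookup y i         ≡⟨ []≔-lookup y i ⟩
    y                           ∎
    where open ≡-Reasoning

  ℓ-base : ∀ (i : Fin d) (A : FinSet d) {x y : Pt d} → base i x ≡ base i y → ℓ i A x ≡ ℓ i A y
  ℓ-base i A = cong (λ b → length (map (λ a → lookup a i) (filter (λ a → base i a ≟ᵖ b) A)))

step : ∀ {d} → Pt d → Fin d → Pt d → Pt d
step s i w = w [ i ]≔ (lookup w i ℤ.+ lookup s i)

step-injective : ∀ {d} (s : Pt d) i → Injective _≡_ _≡_ (step s i)
step-injective s i {x} {y} eq = base∧lookup⇒≡ i
  (trans (sym (base-update i x _)) (trans (cong (base i) eq) (base-update i y _)))
  (ℤ-+-cancelʳ (lookup s i) _ _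
    (trans (sym (lookup∘update i x _)) (trans (cong (λ w → lookup w i) eq) (lookup∘update i y _))))

walk : ∀ {d} → Pt d → List (Fin d) → Pt d → Pt d
walk s [] x = x
walk s (i ∷ is) x = walk s is (step s i x)

walk-map-suc : ∀ {d} σ (s : Pt d) is c (x : Pt d) → walk (σ ∷ s) (map suc is) (c ∷ x) ≡ c ∷ walk s is x
walk-map-suc σ s [] c x = refl
walk-map-suc σ s (i ∷ is) c x = walk-map-suc σ s is c (step s i x)

walk-allFin : ∀ {d} (s x : Pt d) → walk s (allFin d) x ≡ x +ᵖ s
walk-allFin [] [] = refl
walk-allFin {suc d} (σ ∷ s) (c ∷ x) = begin
  walk (σ ∷ s) (tabulate suc) ((c ℤ.+ σ) ∷ x)
    ≡⟨ cong (λ is → walk (σ ∷ s) is ((c ℤ.+ σ) ∷ x)) (map-tabulate (λ i → i) suc) ⟨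
  walk (σ ∷ s) (map suc (allFin d)) ((c ℤ.+ σ) ∷ x)
    ≡⟨ walk-map-suc σ s (allFin d) (c ℤ.+ σ) x ⟩
  (c ℤ.+ σ) ∷ walk s (allFin d) x
    ≡⟨ cong ((c ℤ.+ σ) ∷_) (walk-allFin s x) ⟩
  (c ℤ.+ σ) ∷ (x +ᵖ s)
    ∎
  where open ≡-Reasoning

module DownSetShift {d} (N : Fin d → ℕ) (D : FinSet d) (D↓ : DownSet D) (D⊆P : All (InBox N) D)
                    (s : Pt d) where

  open DecMembership (_≟ᵖ_ {d}) using (_∈?_)

  half : Fin d → Pt d → ℤ
  half i w = + (ℓ i D w / 2)

  toFacet : Fin d → Pt d → Pt d
  toFacet i w = w [ i ]≔ exitDistance (lookup s i) (half i w) (lookup w i)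

  toFacet-injective : ∀ i → Injective _≡_ _≡_ (toFacet i)
  toFacet-injective i {x} {y} eq =
    base∧lookup⇒≡ i bx≡by (exitDistance-injective (lookup s i) (half i x) dx≡dy)
    where
    bx≡by : base i x ≡ base i y
    bx≡by = trans (sym (base-update i x _)) (trans (cong (base i) eq) (base-update i y _))
    dx≡dy : exitDistance (lookup s i) (half i x) (lookup x i) ≡ exitDistance (lookup s i) (half i x) (lookup y i)
    dx≡dy = begin
      exitDistance (lookup s i) (half i x) (lookup x i) ≡⟨ lookup∘update i x _ ⟨
      lookup (toFacet i x) i                            ≡⟨ cong (λ w → lookup w i) eq ⟩
      lookup (toFacet i y) i                            ≡⟨ lookup∘update i y _ ⟩
      exitDistance (lookup s i) (half i y) (lookup y i)
        ≡⟨ cong (λ L → exitDistance (lookup s i) (+ (L / 2)) (lookup y i)) (ℓ-base i D bx≡by) ⟨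
      exitDistance (lookup s i) (half i x) (lookup y i) ∎
      where open ≡-Reasoning

  facetLo : Fin d → Fin d → ℤ
  facetLo i = updateAt (λ j → - + N j) i (const 0ℤ)

  facetSides : Fin d → Fin d → ℕ
  facetSides i = updateAt (sideLength N) i (const ∣ lookup s i ∣)

  step∉D⇒¬InI : ∀ i w → w ∈ D → step s i w ∉ D → ¬ InI (ℓ i D w) (lookup w i ℤ.+ lookup s i)
  step∉D⇒¬InI i w w∈D stepw∉D inI with Equivalence.to (D↓ i w) w∈D
  ... | 0<ℓ , _ = stepw∉D (Equivalence.from (D↓ i (step s i w))
    (subst₂ (λ L c → 0 < L × InI L c) (sym (ℓ-base i D (base-update i w _))) (sym (lookup∘update i w _))
      (0<ℓ , inI)))

  toFacet-normal : ∀ i w → w ∈ D → step s i w ∉ D →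
    InInterval (facetLo i i) (facetSides i i) (lookup (toFacet i w) i)
  toFacet-normal i w w∈D stepw∉D
    rewrite updateAt-updates i {const 0ℤ} (λ j → - + N j)
          | updateAt-updates i {const ∣ lookup s i ∣} (sideLength N)
          | lookup∘update i w (exitDistance (lookup s i) (half i w) (lookup w i))
    with Equivalence.to (D↓ i w) w∈D
  ... | _ , -m≤wi , wi≤m =
    exitDistance-range (lookup s i) (half i w) (lookup w i) -m≤wi wi≤m (step∉D⇒¬InI i w w∈D stepw∉D)

  toFacet-tangent : ∀ i j w → j ≢ i → w ∈ D →
    InInterval (facetLo i j) (facetSides i j) (lookup (toFacet i w) j)
  toFacet-tangent i j w j≢i w∈D
    rewrite updateAt-minimal j i {const 0ℤ} (λ j → - + N j) j≢i
          | updateAt-minimal j i {const ∣ lookup s i ∣} (sideLength N) j≢i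
          | lookup∘update′ j≢i w (exitDistance (lookup s i) (half i w) (lookup w i))
    with All.lookup D⊆P w∈D j
  ... | -N≤wj , wj≤N = -N≤wj , x≤n⇒x<-n+[1+2n] (N j) wj≤N

  toFacet-inRange : ∀ i w → w ∈ D → step s i w ∉ D → InRange (facetLo i) (facetSides i) (toFacet i w)
  toFacet-inRange i w w∈D stepw∉D j with j Fin.≟ i
  ... | yes refl = toFacet-normal j w w∈D stepw∉D
  ... | no j≢i = toFacet-tangent i j w j≢i w∈D

  leavesD : Pt d → Pt d → ℕ
  leavesD = leaves (_∈? D)

  sum-leaves-≤ : ∀ i (g : Pt d → Pt d) → Injective _≡_ _≡_ g → (X : FinSet d) → Unique X →
    sum (map (λ a → leavesD (g a) (step s i (g a))) X) ≤ facetSize N i * ∣ lookup s i ∣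
  sum-leaves-≤ i g g-injective X X! = begin
    sum (map (λ a → 𝟙 (Leaves? a)) X)                 ≡⟨ sum-map-𝟙 Leaves? X ⟩
    length (filter Leaves? X)                         ≡⟨ length-map (toFacet i ∘ g) (filter Leaves? X) ⟨
    length (map (toFacet i ∘ g) (filter Leaves? X))   ≤⟨ Unique∧InRange⇒length≤ images! images∈ ⟩
    product (tabulate (facetSides i))                 ≡⟨ product-updateAt (sideLength N) i _ ⟩
    facetSize N i * ∣ lookup s i ∣                    ∎
    where
    open ≤-Reasoning
    Leaves? = λ a → (g a ∈? D) ×-dec ¬? (step s i (g a) ∈? D)
    images! = Unique.map⁺ (g-injective ∘ toFacet-injective i) (Unique.filter⁺ Leaves? X!)
    images∈ = All-map⁺ (All.map (λ (ga∈D , stepga∉D) → toFacet-inRange i (g _) ga∈D stepga∉D)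
                                 (all-filter Leaves? X))

  exits : Pt d → List (Fin d) → ℕ
  exits x [] = 0
  exits x (i ∷ is) = leavesD x (step s i x) + exits (step s i x) is

  leaves-walk≤exits : ∀ x is → leavesD x (walk s is x) ≤ exits x is
  leaves-walk≤exits x [] = ≤-reflexive (leaves-self (_∈? D) x)
  leaves-walk≤exits x (i ∷ is) = ≤-trans (leaves-triangle (_∈? D) x (step s i x) (walk s is (step s i x)))
    (+-monoʳ-≤ (leavesD x (step s i x)) (leaves-walk≤exits (step s i x) is))

  sum-exits-≤ : ∀ (g : Pt d → Pt d) → Injective _≡_ _≡_ g → (X : FinSet d) → Unique X → ∀ is →
    sum (map (λ a → exits (g a) is) X) ≤ sum (map (λ i → facetSize N i * ∣ lookup s i ∣) is)
  sum-exits-≤ g g-injective X X! [] = ≤-reflexive (trans (sum-map-const 0 X) (*-zeroʳ (length X)))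
  sum-exits-≤ g g-injective X X! (i ∷ is) = begin
    sum (map (λ a → leavesD (g a) (step s i (g a)) + exits (step s i (g a)) is) X)
      ≡⟨ sum-map-+ _ _ X ⟩
    sum (map (λ a → leavesD (g a) (step s i (g a))) X) + sum (map (λ a → exits (step s i (g a)) is) X)
      ≤⟨ +-mono-≤ (sum-leaves-≤ i g g-injective X X!)
                  (sum-exits-≤ (step s i ∘ g) (g-injective ∘ step-injective s i) X X! is) ⟩
    facetSize N i * ∣ lookup s i ∣ + sum (map (λ i → facetSize N i * ∣ lookup s i ∣) is)
      ∎
    where open ≤-Reasoning

  𝟙∈≤𝟙∈-shift+exits : ∀ x → 𝟙 (x ∈? D) ≤ 𝟙 ((x +ᵖ s) ∈? D) + exits x (allFin d)
  𝟙∈≤𝟙∈-shift+exits x = begin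
    𝟙 (x ∈? D)
      ≤⟨ 𝟙≤𝟙+leaves (_∈? D) x (walk s (allFin d) x) ⟩
    𝟙 (walk s (allFin d) x ∈? D) + leavesD x (walk s (allFin d) x)
      ≤⟨ +-monoʳ-≤ _ (leaves-walk≤exits x (allFin d)) ⟩
    𝟙 (walk s (allFin d) x ∈? D) + exits x (allFin d)
      ≡⟨ cong (λ y → 𝟙 (y ∈? D) + exits x (allFin d)) (walk-allFin s x) ⟩
    𝟙 ((x +ᵖ s) ∈? D) + exits x (allFin d)
      ∎
    where open ≤-Reasoning

norm₁ : ∀ {d} → Pt d → ℕ
norm₁ {d} s = sum (map (λ j → ∣ lookup s j ∣) (allFin d))

S₂-shift : ∀ {d} (N : Fin d → ℕ) (s : Pt d) (A : Fin 2 → FinSet d) →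
  Unique (A zero) → Unique (A (suc zero)) → DownSet (A (suc zero)) → All (InBox N) (A (suc zero)) →
  ∀ t → S 2 A t ≤ S 2 A (t +ᵖ s) + norm₁ s * boundary N
S₂-shift {d} N s A X! D! D↓ D⊆P t = begin
  S 2 A t
    ≡⟨ cong sum (map-cong (λ a → S₁≡𝟙∈ (A ∘ suc) D! (t -ᵖ a)) X) ⟩
  sum (map (λ a → 𝟙 ((t -ᵖ a) ∈? D)) X)
    ≤⟨ sum-map-mono (λ a → 𝟙∈≤𝟙∈-shift+exits (t -ᵖ a)) X ⟩
  sum (map (λ a → 𝟙 (((t -ᵖ a) +ᵖ s) ∈? D) + exits (t -ᵖ a) (allFin d)) X)
    ≡⟨ sum-map-+ _ _ X ⟩
  sum (map (λ a → 𝟙 (((t -ᵖ a) +ᵖ s) ∈? D)) X) + sum (map (λ a → exits (t -ᵖ a) (allFin d)) X)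
    ≤⟨ +-mono-≤ (≤-reflexive shifted≡) (sum-exits-≤ (t -ᵖ_) (-ᵖ-injective t) X X! (allFin d)) ⟩
  S 2 A (t +ᵖ s) + sum (map (λ i → facetSize N i * ∣ lookup s i ∣) (allFin d))
    ≤⟨ +-monoʳ-≤ _ (sum-map-*-≤ (facetSize N) (λ i → ∣ lookup s i ∣) (allFin d)) ⟩
  S 2 A (t +ᵖ s) + sum (map (facetSize N) (allFin d)) * norm₁ s
    ≡⟨ cong (λ b → S 2 A (t +ᵖ s) + b * norm₁ s) (boundary≡sum-facetSize N) ⟨
  S 2 A (t +ᵖ s) + boundary N * norm₁ s
    ≡⟨ cong (_+_ (S 2 A (t +ᵖ s))) (*-comm (boundary N) (norm₁ s)) ⟩
  S 2 A (t +ᵖ s) + norm₁ s * boundary N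
    ∎
  where
  open ≤-Reasoning
  open DecMembership (_≟ᵖ_ {d}) using (_∈?_)
  open DownSetShift N (A (suc zero)) D↓ D⊆P s
  X = A zero
  D = A (suc zero)
  shifted≡ : sum (map (λ a → 𝟙 (((t -ᵖ a) +ᵖ s) ∈? D)) X) ≡ S 2 A (t +ᵖ s)
  shifted≡ = cong sum (map-cong (λ a → trans (cong (λ y → 𝟙 (y ∈? D)) ([t-a]+s≡[t+s]-a t a s))
                                             (sym (S₁≡𝟙∈ (A ∘ suc) D! _))) X)

prodFirst-suc : ∀ {d} k (A : Fin (3 + k) → FinSet d) →
  prodFirst (3 + k) A ≡ length (A zero) * prodFirst (2 + k) (A ∘ suc)
prodFirst-suc k A = cong (λ ns → length (A zero) * product ns) (begin
  map (length ∘ A) (filter (λ i → 2 + toℕ i <? 3 + k) (tabulate suc))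
    ≡⟨ cong (λ is → map (length ∘ A) (filter (λ i → 2 + toℕ i <? 3 + k) is)) (map-tabulate (λ i → i) suc) ⟨
  map (length ∘ A) (filter (λ i → 2 + toℕ i <? 3 + k) (map suc (allFin (2 + k))))
    ≡⟨ filter-map-suc (allFin (2 + k)) ⟩
  map (length ∘ A ∘ suc) (filter (λ i → 2 + toℕ i <? 2 + k) (allFin (2 + k)))
    ∎)
  where
  open ≡-Reasoning
  filter-map-suc : ∀ is → map (length ∘ A) (filter (λ i → 2 + toℕ i <? 3 + k) (map suc is))
                        ≡ map (length ∘ A ∘ suc) (filter (λ i → 2 + toℕ i <? 2 + k) is)
  filter-map-suc [] = refl
  filter-map-suc (i ∷ is) with does (2 + toℕ i <? 2 + k)
  ... | true = cong (length (A (suc i)) ∷_) (filter-map-suc is)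
  ... | false = filter-map-suc is

S-shift : ∀ {d} (N : Fin d → ℕ) (s : Pt d) k (A : Fin (2 + k) → FinSet d) →
  (∀ i → Unique (A i)) → DownSet (A (fromℕ (suc k))) → All (InBox N) (A (fromℕ (suc k))) → ∀ t →
  S (2 + k) A t ≤ S (2 + k) A (t +ᵖ s) + norm₁ s * prodFirst (2 + k) A * boundary N
S-shift N s zero A A! A↓ A⊆P t =
  subst (λ c → S 2 A t ≤ S 2 A (t +ᵖ s) + c * boundary N) (sym (*-identityʳ (norm₁ s)))
    (S₂-shift N s A (A! zero) (A! (suc zero)) A↓ A⊆P t)
S-shift N s (suc k) A A! A↓ A⊆P t = begin
  sum (map (λ a → S (2 + k) A′ (t -ᵖ a)) (A zero))
    ≤⟨ sum-map-mono (λ a → S-shift N s k A′ (A! ∘ suc) A↓ A⊆P (t -ᵖ a)) (A zero) ⟩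
  sum (map (λ a → S (2 + k) A′ ((t -ᵖ a) +ᵖ s) + K) (A zero))
    ≡⟨ sum-map-+ _ _ (A zero) ⟩
  sum (map (λ a → S (2 + k) A′ ((t -ᵖ a) +ᵖ s)) (A zero)) + sum (map (λ _ → K) (A zero))
    ≡⟨ cong₂ _+_ (cong sum (map-cong (λ a → cong (S (2 + k) A′) ([t-a]+s≡[t+s]-a t a s)) (A zero)))
                 (sum-map-const K (A zero)) ⟩
  S (3 + k) A (t +ᵖ s) + length (A zero) * K
    ≡⟨ cong (_+_ (S (3 + k) A (t +ᵖ s))) (reassociate (length (A zero)) (norm₁ s) (prodFirst (2 + k) A′) (boundary N)) ⟩
  S (3 + k) A (t +ᵖ s) + norm₁ s * (length (A zero) * prodFirst (2 + k) A′) * boundary N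
    ≡⟨ cong (λ p → S (3 + k) A (t +ᵖ s) + norm₁ s * p * boundary N) (prodFirst-suc k A) ⟨
  S (3 + k) A (t +ᵖ s) + norm₁ s * prodFirst (3 + k) A * boundary N
    ∎
  where
  open ≤-Reasoning
  A′ = A ∘ suc
  K = norm₁ s * prodFirst (2 + k) A′ * boundary N
  reassociate : ∀ n c p b → n * (c * p * b) ≡ c * (n * p) * b
  reassociate = solve-∀

lemma4p4 : (d k : ℕ) → 1 ≤ d → 3 ≤ k → (s : Pt d) →
    ∃ λ (C : ℕ) →
      (N : Fin d → ℕ) (A : Fin k → FinSet d) →
      (∀ i → Unique (A i)) →
      (∀ i → All (InBox N) (A i)) →
      (∀ (i j : Fin k) → toℕ i ≤ toℕ j → length (A i) ≤ length (A j)) →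
      (∀ (i : Fin k) → toℕ i + 1 ≡ k → DownSet (A i)) →
      E k A ≤ S k A s + C * prodFirst k A * boundary N
lemma4p4 d (suc (suc (suc k))) _ (s≤s (s≤s (s≤s _))) s = norm₁ s , λ N A A! A⊆P _ A↓ →
  subst (λ t → E (3 + k) A ≤ S (3 + k) A t + norm₁ s * prodFirst (3 + k) A * boundary N) (0ᵖ+ᵖ s)
    (S-shift N s (suc k) A A! (A↓ last toℕ[last]+1≡3+k) (A⊆P last) 0ᵖ)
  where
  last = fromℕ (2 + k)
  toℕ[last]+1≡3+k : toℕ last + 1 ≡ 3 + k
  toℕ[last]+1≡3+k = trans (cong (_+ 1) (toℕ-fromℕ (2 + k))) (+-comm (2 + k) 1)
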